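{- Let $\Phi\colon\mathbb{R}^2\to[0,\infty)$ be any non-negative function, and let $$S=\sum_{n\ge1}\sum_{\sigma\in\Sigma_n}\Phi\bigl(q_n^*(\sigma),q_{n-1}^*(\sigma)\bigr).$$ Then, as an equality in $[0,\infty]$, $$S=-2\Phi(1,0)+\Phi(1,1)+2\sum_{j\ge1}\ \sum_{\substack{0\le k<j\\ \gcd(j,k)=1}}\Phi(j,k).$$
   Context: For $n\in\mathbb{N}$, $\Sigma_n=\mathbb{N}^n\times\{\infty\}^{\mathbb{N}\setminus\{1,\dots,n\}}$, identified with $\mathbb{N}^n$. For $\sigma=(\sigma_1,\dots,\sigma_n)\in\Sigma_n$ and $0\le k\le n$, $q_k^*(\sigma)$ is the denominator in lowest terms (positive) of the continued fraction $[0;\sigma_1,\dots,\sigma_k]=\cfrac{1}{\sigma_1+\cfrac{1}{\ddots+\cfrac{1}{\sigma_k}}}$, with $q_0^*(\sigma)=1$. Note $\gcd(j,0)=j$, so $(1,0)$ is the only pair with $k=0$ in the last sum.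
   Formalization: The function Φ takes values in the non-negative rationals instead of $[0,\infty)$. -}

module Defs where

open import Data.Nat using (ℕ; zero; suc; _*_; _∸_)
import Data.Nat as N
open import Data.Nat.DivMod using (_/_)
open import Data.Nat.GCD using (gcd)
open import Data.Product using (_×_; _,_; ∃)
open import Data.List using (List; []; _∷_; map; concatMap; foldr; upTo; filter; take)
open import Data.Vec using (Vec; toList)
import Data.Vec as V
open import Data.Rational using (ℚ; 0ℚ; _+_; _≤_)
open import Relation.Binary.PropositionalEquality using (_≡_)
open import Data.Nat.Properties using (_≟_)

-- Unreduced value of the finite continued fraction [0; a₁, …, a_k] as a pair
-- (numerator , denominator) of naturals:  [0;] = 0/1 and
-- [0; a, rest] = 1 / (a + p/q) = q / (a*q + p)  where p/q = [0; rest].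
cfFrac : List ℕ → ℕ × ℕ
cfFrac [] = 0 , 1
cfFrac (a ∷ as) with cfFrac as
... | p , q = q , (a * q N.+ p)

reducedDen : ℕ → ℕ → ℕ
reducedDen p q with gcd p q
... | zero  = q
... | suc g = q / suc g

qStar : ∀ {n} → Vec ℕ n → ℕ → ℕ
qStar σ k with cfFrac (take k (toList σ))
... | p , q = reducedDen p q

oneTo : ℕ → List ℕ
oneTo N = map suc (upTo N)

-- all σ ∈ {1,…,N}^n  (finite truncations exhausting Σ_n = ℕ^n, ℕ = {1,2,…})
tuples : (N n : ℕ) → List (Vec ℕ n)
tuples N zero = V.[] ∷ []
tuples N (suc n) = concatMap (λ a → map (a V.∷_) (tuples N n)) (oneTo N)

sumℚ : List ℚ → ℚ
sumℚ = foldr _+_ 0ℚ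

twice : ℚ → ℚ
twice x = x + x

-- N-th partial sum of S = Σ_{n≥1} Σ_{σ∈Σ_n} Φ(q*_n(σ), q*_{n-1}(σ)):
-- n ranges over 1..N and σ over {1..N}^n.
Spartial : (ℕ → ℕ → ℚ) → ℕ → ℚ
Spartial Φ N =
  sumℚ (concatMap (λ n → map (λ σ → Φ (qStar σ n) (qStar σ (n ∸ 1))) (tuples N n)) (oneTo N))

Tpartial : (ℕ → ℕ → ℚ) → ℕ → ℚ
Tpartial Φ N =
  sumℚ (concatMap (λ j → map (λ k → Φ j k) (filter (λ k → gcd j k ≟ 1) (upTo j))) (oneTo N))

-- Equality in [0,∞] of the suprema of two nondecreasing sequences of
-- partial sums  a , b : ℕ → ℚ  (mutual domination).
SupEq : (ℕ → ℚ) → (ℕ → ℚ) → Set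
SupEq a b = (∀ N → ∃ λ M → a N ≤ b M) × (∀ N → ∃ λ M → b N ≤ a M)

{-# OPTIONS --safe #-}
-- The matrix of [0; σ₁, …, σₙ] is a product of symmetric generators, so reversing σ transposes
-- it: (q*ₙ(σ), q*ₙ₋₁(σ)) is the pair (den, num) of [0; σₙ, …, σ₁], already in lowest terms.
-- By Euclid's algorithm a word of positive digits is determined by this fraction and the parity
-- of its length; every coprime 0 < k < j has one expansion of each parity, (1, 1) only [1] and
-- (1, 0) only the empty word.  Labelling the words of length and digits ≤ N by (parity, den, num)
-- and adding the two labels (parity, 1, 0) thus embeds them into two copies of the coprime pairs
-- with j ≤ (N+1)^N plus (1, 1); conversely every such label with j ≤ N comes from a word of
-- length and digits ≤ N + 1.  As Φ ≥ 0, each partial sum is bounded by a later one of the other side.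
module Submission where

open import Defs
open import Data.Bool using (Bool; true; false; not)
open import Data.Empty using (⊥; ⊥-elim)
open import Data.List using (List; []; _∷_; [_]; _++_; _∷ʳ_; foldr; map; concatMap; filter; upTo; reverse; length; take)
open import Data.List.Membership.Propositional using (_∈_; _∉_; find; lose)
open import Data.List.Membership.Propositional.Properties
  using (∈-map⁺; ∈-map⁻; ∈-++⁺ˡ; ∈-++⁺ʳ; ∈-++⁻; ∈-∃++; ∈-concatMap⁺; ∈-concatMap⁻; ∈-upTo⁺; ∈-upTo⁻; ∈-filter⁺; ∈-filter⁻)
open import Data.List.Properties
  using (unfold-reverse; reverse-++; reverse-injective; reverse-involutive; length-reverse; take-all;
         map-++; map-∘; map-cong; concatMap-cong; concatMap-map; map-concatMap)
open import Data.List.Relation.Binary.Disjoint.Propositional using (Disjoint)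
open import Data.List.Relation.Binary.Subset.Propositional using (_⊆_)
open import Data.List.Relation.Unary.All as All using (All; []; _∷_)
import Data.List.Relation.Unary.All.Properties as All
open import Data.List.Relation.Unary.AllPairs using ([]; _∷_)
import Data.List.Relation.Unary.AllPairs as AllPairs
import Data.List.Relation.Unary.AllPairs.Properties as AllPairs
open import Data.List.Relation.Unary.Any using (here; there)
open import Data.List.Relation.Unary.Unique.Propositional using (Unique)
open import Data.List.Relation.Unary.Unique.Propositional.Properties using (concat⁺; map⁺; filter⁺; upTo⁺; ++⁺)
open import Data.Nat using (ℕ; zero; suc; _∸_; _^_)
open import Data.Nat.Coprimality as Coprimality using (Coprime; coprime⇒gcd≡1; gcd≡1⇒coprime; 1-coprimeTo)
open import Data.Product using (_×_; _,_; ∃-syntax; proj₁; proj₂; uncurry)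
open import Data.Sum using (inj₁; inj₂)
open import Data.Vec as Vec using (Vec; toList; fromList; initLast)
open import Data.Vec.Properties using (toList-injective; toList-∷ʳ; toList∘fromList; length-toList)
open import Data.Vec.Relation.Binary.Equality.Cast using (cast-is-id)
open import Function using (_∘_)
open import Relation.Binary.PropositionalEquality
  using (_≡_; _≢_; refl; sym; trans; cong; cong₂; subst; subst₂; module ≡-Reasoning)

private
  variable
    A B : Set

∈-concatMap⁺′ : ∀ (f : A → List B) {xs x y} → x ∈ xs → y ∈ f x → y ∈ concatMap f xs
∈-concatMap⁺′ f x∈ y∈ = ∈-concatMap⁺ f (lose x∈ y∈)

∈-concatMap⁻′ : ∀ (f : A → List B) xs {y} → y ∈ concatMap f xs → ∃[ x ] x ∈ xs × y ∈ f x
∈-concatMap⁻′ f _ y∈ = find (∈-concatMap⁻ f y∈)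

concatMap-unique : ∀ (key : B → A) {f : A → List B} {xs} → Unique xs → (∀ x → Unique (f x)) →
                   (∀ {x y} → y ∈ f x → key y ≡ x) → Unique (concatMap f xs)
concatMap-unique key {f} xs! f! key-f =
  concat⁺ (All.map⁺ (All.universal f! _)) (AllPairs.map⁺ (AllPairs.map disjoint xs!))
  where
  disjoint : ∀ {x x′} → x ≢ x′ → Disjoint (f x) (f x′)
  disjoint x≢x′ (y∈ , y∈′) = x≢x′ (trans (sym (key-f y∈)) (key-f y∈′))

map-unique : ∀ {f : A → B} {xs} → Unique xs → (∀ {x y} → x ∈ xs → y ∈ xs → f x ≡ f y → x ≡ y) → Unique (map f xs)
map-unique []          _   = []
map-unique (x∉ ∷ xs!) inj =
  All.map⁺ (All.tabulate λ y∈ fx≡fy → All.lookup x∉ y∈ (inj (here refl) (there y∈) fx≡fy))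
  ∷ map-unique xs! (λ x∈ y∈ → inj (there x∈) (there y∈))

All-reverse : ∀ {P : A → Set} {xs} → All P xs → All P (reverse xs)
All-reverse {xs = []}     []         = []
All-reverse {xs = x ∷ xs} (px ∷ pxs) = subst (All _) (sym (unfold-reverse x xs)) (All.++⁺ (All-reverse pxs) (px ∷ []))

module ContinuedFractions where

  open import Data.Bool.Properties using (not-injective; not-involutive)
  open import Data.Nat using (_+_; _*_; _≤_; _<_; z≤n; s≤s; z<s; >-nonZero)
  open import Data.Nat.DivMod using (_/_; _%_; n/1≡n; m≡m%n+[m/n]*n; m%n<n; [m+kn]%n≡m%n; m<n⇒m%n≡m; m≥n⇒m/n>0)
  open import Data.Nat.Divisibility using (∣-refl; ∣-trans; n∣m*n; ∣m+n∣m⇒∣n; ∣m∣n⇒∣m+n; ∣1⇒≡1; m%n≡0⇒n∣m)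
  open import Data.Nat.Properties
  open import Data.Nat.Tactic.RingSolver using (solve-∀)
  open import Induction.WellFounded using (Acc; acc)

  private
    variable
      ρ ρ′ τ τ′ : List ℕ
      j k x : ℕ

  coprime-*+⁺ : ∀ {m n} k → Coprime m n → Coprime m (k * m + n)
  coprime-*+⁺ k coprime (d∣m , d∣km+n) = coprime (d∣m , ∣m+n∣m⇒∣n d∣km+n (∣-trans d∣m (n∣m*n k)))

  coprime-*+⁻ : ∀ {m n} k → Coprime m (k * m + n) → Coprime m n
  coprime-*+⁻ k coprime (d∣m , d∣n) = coprime (d∣m , ∣m∣n⇒∣m+n (∣-trans d∣m (n∣m*n k)) d∣n)

  remainder-unique : ∀ {q q′ d r r′} → r < d → r′ < d → q * d + r ≡ q′ * d + r′ → r ≡ r′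
  remainder-unique {q} {q′} {d@(suc _)} {r} {r′} r<d r′<d eq = begin
    r                 ≡⟨ remainder q r<d ⟨
    (q * d + r) % d   ≡⟨ cong (_% d) eq ⟩
    (q′ * d + r′) % d ≡⟨ remainder q′ r′<d ⟩
    r′                ∎
    where
    open ≡-Reasoning
    remainder : ∀ q {r} → r < d → (q * d + r) % d ≡ r
    remainder q {r} r<d = trans (cong (_% d) (+-comm (q * d) r)) (trans ([m+kn]%n≡m%n r q d) (m<n⇒m%n≡m r<d))

  num den : List ℕ → ℕ
  num ρ = proj₁ (cfFrac ρ)
  den ρ = proj₂ (cfFrac ρ)

  -- mat a b c d is the matrix (a b ; c d);  x ◁ M = G x · M  and  M ▷ x = M · G x  for  G x = (0 1 ; 1 x).
  record Mat : Set where
    constructor mat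
    field a b c d : ℕ

  transpose : Mat → Mat
  transpose (mat a b c d) = mat a c b d

  _◁_ : ℕ → Mat → Mat
  x ◁ mat a b c d = mat c d (x * c + a) (x * d + b)

  _▷_ : Mat → ℕ → Mat
  mat a b c d ▷ x = mat b (x * b + a) d (x * d + c)

  convergentMat : List ℕ → Mat
  convergentMat = foldr _◁_ (mat 1 0 0 1)

  cfFrac-convergentMat : ∀ ρ → cfFrac ρ ≡ (Mat.b (convergentMat ρ) , Mat.d (convergentMat ρ))
  cfFrac-convergentMat []      = refl
  cfFrac-convergentMat (x ∷ ρ) = cong (λ (p , q) → q , x * q + p) (cfFrac-convergentMat ρ)

  ◁-▷-assoc : ∀ x M y → x ◁ (M ▷ y) ≡ (x ◁ M) ▷ y
  ◁-▷-assoc x (mat a b c d) y = cong (mat d (y * d + c) (x * d + b)) (bottom-right x y a b c d)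
    where
    bottom-right : ∀ x y a b c d → x * (y * d + c) + (y * b + a) ≡ y * (x * d + b) + (x * c + a)
    bottom-right = solve-∀

  convergentMat-∷ʳ : ∀ ρ y → convergentMat (ρ ∷ʳ y) ≡ convergentMat ρ ▷ y
  convergentMat-∷ʳ []      y rewrite *-zeroʳ y = refl
  convergentMat-∷ʳ (x ∷ ρ) y = trans (cong (x ◁_) (convergentMat-∷ʳ ρ y)) (◁-▷-assoc x (convergentMat ρ) y)

  convergentMat-reverse : ∀ ρ → convergentMat (reverse ρ) ≡ transpose (convergentMat ρ)
  convergentMat-reverse []      = refl
  convergentMat-reverse (x ∷ ρ) = begin
    convergentMat (reverse (x ∷ ρ))       ≡⟨ cong convergentMat (unfold-reverse x ρ) ⟩
    convergentMat (reverse ρ ∷ʳ x)        ≡⟨ convergentMat-∷ʳ (reverse ρ) x ⟩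
    convergentMat (reverse ρ) ▷ x         ≡⟨ cong (_▷ x) (convergentMat-reverse ρ) ⟩
    transpose (convergentMat ρ) ▷ x       ∎
    where open ≡-Reasoning

  den-reverse : ∀ ρ → den (reverse ρ) ≡ den ρ
  den-reverse ρ = begin
    den (reverse ρ)                       ≡⟨ cong proj₂ (cfFrac-convergentMat (reverse ρ)) ⟩
    Mat.d (convergentMat (reverse ρ))     ≡⟨ cong Mat.d (convergentMat-reverse ρ) ⟩
    Mat.d (convergentMat ρ)               ≡⟨ cong proj₂ (cfFrac-convergentMat ρ) ⟨
    den ρ                                 ∎
    where open ≡-Reasoning

  cfFrac-coprime : ∀ ρ → Coprime (num ρ) (den ρ)
  cfFrac-coprime []      (_ , d∣1) = ∣1⇒≡1 d∣1
  cfFrac-coprime (x ∷ ρ) = coprime-*+⁺ x (Coprimality.sym (cfFrac-coprime ρ))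

  reducedDen-coprime : ∀ {p q} → Coprime p q → reducedDen p q ≡ q
  reducedDen-coprime {p} {q} coprime rewrite coprime⇒gcd≡1 coprime = n/1≡n q

  qStar≡den-take : ∀ {n} (σ : Vec ℕ n) k → qStar σ k ≡ den (take k (toList σ))
  qStar≡den-take σ k = reducedDen-coprime (cfFrac-coprime (take k (toList σ)))

  take-length-++ : ∀ (xs ys : List ℕ) → take (length xs) (xs ++ ys) ≡ xs
  take-length-++ []       ys = refl
  take-length-++ (x ∷ xs) ys = cong (x ∷_) (take-length-++ xs ys)

  qStar-last : ∀ {m} (σ : Vec ℕ (suc m)) → qStar σ (suc m) ≡ den (reverse (toList σ))
  qStar-last {m} σ = begin
    qStar σ (suc m)                  ≡⟨ qStar≡den-take σ (suc m) ⟩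
    den (take (suc m) (toList σ))    ≡⟨ cong den (take-all (suc m) (toList σ) (≤-reflexive (length-toList σ))) ⟩
    den (toList σ)                   ≡⟨ den-reverse (toList σ) ⟨
    den (reverse (toList σ))         ∎
    where open ≡-Reasoning

  qStar-init : ∀ {m} (σ : Vec ℕ (suc m)) → qStar σ m ≡ num (reverse (toList σ))
  qStar-init {m} σ with initLast σ
  ... | τ , a , refl = begin
    qStar (τ Vec.∷ʳ a) m                                ≡⟨ qStar≡den-take (τ Vec.∷ʳ a) m ⟩
    den (take m (toList (τ Vec.∷ʳ a)))                  ≡⟨ cong (den ∘ take m) (toList-∷ʳ a τ) ⟩
    den (take m (toList τ ++ [ a ]))                    ≡⟨ cong (λ n → den (take n (toList τ ++ [ a ]))) (length-toList τ) ⟨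
    den (take (length (toList τ)) (toList τ ++ [ a ]))  ≡⟨ cong den (take-length-++ (toList τ) [ a ]) ⟩
    den (toList τ)                                      ≡⟨ den-reverse (toList τ) ⟨
    num (a ∷ reverse (toList τ))                        ≡⟨ cong num (reverse-++ (toList τ) [ a ]) ⟨
    num (reverse (toList τ ++ [ a ]))                   ≡⟨ cong (num ∘ reverse) (toList-∷ʳ a τ) ⟨
    num (reverse (toList (τ Vec.∷ʳ a)))                 ∎
    where open ≡-Reasoning

  den≤den-∷ : ∀ ρ → 0 < x → den ρ ≤ den (x ∷ ρ)
  den≤den-∷ {x} ρ x>0 = ≤-trans (m≤n*m (den ρ) x {{>-nonZero x>0}}) (m≤m+n (x * den ρ) (num ρ))

  num≤den : All (0 <_) ρ → num ρ ≤ den ρ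
  num≤den []                = z≤n
  num≤den {_ ∷ ρ} (x>0 ∷ _) = den≤den-∷ ρ x>0

  den-pos : All (0 <_) ρ → 0 < den ρ
  den-pos []                  = z<s
  den-pos {_ ∷ ρ} (x>0 ∷ ρ>0) = <-≤-trans (den-pos ρ>0) (den≤den-∷ ρ x>0)

  num-pos : All (0 <_) ρ → 0 < length ρ → 0 < num ρ
  num-pos (_ ∷ τ>0) _ = den-pos τ>0

  num-pos⇒length-pos : ∀ ρ → 0 < num ρ → 0 < length ρ
  num-pos⇒length-pos (_ ∷ _) _ = z<s

  num≡0⇒≡[] : All (0 <_) ρ → num ρ ≡ 0 → ρ ≡ []
  num≡0⇒≡[] []         _   = refl
  num≡0⇒≡[] (_ ∷ ρ>0) num≡0 = ⊥-elim (<⇒≢ (den-pos ρ>0) (sym num≡0))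

  num≡den⇒≡[1] : All (0 <_) ρ → num ρ ≡ den ρ → ρ ≡ [ 1 ]
  num≡den⇒≡[1] (_ ∷ [])               1≡x = cong [_] (sym (trans 1≡x (trans (+-identityʳ _) (*-identityʳ _))))
  num≡den⇒≡[1] {x ∷ y ∷ ρ} (x>0 ∷ ρ>0) eq = ⊥-elim (<⇒≢ num<den eq)
    where
    num<den : den (y ∷ ρ) < x * den (y ∷ ρ) + den ρ
    num<den = ≤-<-trans (m≤n*m (den (y ∷ ρ)) x {{>-nonZero x>0}}) (m<m+n _ (den-pos (All.tail ρ>0)))

  InRange : ℕ → ℕ → Set
  InRange N a = 0 < a × a ≤ N

  positive : ∀ {N ρ} → All (InRange N) ρ → All (0 <_) ρ
  positive = All.map proj₁

  den≤^length : ∀ {N ρ} → All (InRange N) ρ → den ρ ≤ suc N ^ length ρ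
  den≤^length []                                = ≤-refl
  den≤^length {N} {x ∷ ρ} ((_ , x≤N) ∷ ρ∈range) = begin
    x * den ρ + num ρ  ≤⟨ +-mono-≤ (*-mono-≤ x≤N den≤X) (≤-trans (num≤den (positive ρ∈range)) den≤X) ⟩
    N * X + X          ≡⟨ +-comm (N * X) X ⟩
    suc N * X          ∎
    where
    open ≤-Reasoning
    X : ℕ
    X = suc N ^ length ρ
    den≤X : den ρ ≤ X
    den≤X = den≤^length ρ∈range

  oddLength : List ℕ → Bool
  oddLength []      = false
  oddLength (_ ∷ ρ) = not (oddLength ρ)

  -- The hypotheses force τ = [ 1 ] and τ′ = [], the tails of the two expansions [0; …, x, 1] = [0; …, x + 1].
  parity-clash : All (0 <_) τ → All (0 <_) τ′ → num τ ≡ den τ → num τ′ < den τ′ → den τ ≡ den τ′ →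
                 oddLength τ ≡ oddLength τ′ → ⊥
  parity-clash τ>0 τ′>0 num≡den num′<den′ den≡ par with num≡den⇒≡[1] τ>0 num≡den
  ... | refl with num≡0⇒≡[] τ′>0 (n<1⇒n≡0 (<-≤-trans num′<den′ (≤-reflexive (sym den≡))))
  ... | refl with par
  ... | ()

  num-agree : ∀ {x x′ τ τ′} → All (0 <_) τ → All (0 <_) τ′ → oddLength τ ≡ oddLength τ′ → den τ ≡ den τ′ →
              x * den τ + num τ ≡ x′ * den τ′ + num τ′ → num τ ≡ num τ′
  num-agree {x} {x′} {τ} {τ′} τ>0 τ′>0 par den≡ val≡
    with m≤n⇒m<n∨m≡n (num≤den τ>0) | m≤n⇒m<n∨m≡n (num≤den τ′>0)
  ... | inj₁ lt  | inj₁ lt′ = remainder-unique {x} {x′} lt (subst (num τ′ <_) (sym den≡) lt′)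
                                (trans val≡ (cong (λ d → x′ * d + num τ′) (sym den≡)))
  ... | inj₂ eq  | inj₂ eq′ = trans eq (trans den≡ (sym eq′))
  ... | inj₂ eq  | inj₁ lt′ = ⊥-elim (parity-clash τ>0 τ′>0 eq lt′ den≡ par)
  ... | inj₁ lt  | inj₂ eq′ = ⊥-elim (parity-clash τ′>0 τ>0 eq′ lt (sym den≡) (sym par))

  cfFrac-injective : All (0 <_) ρ → All (0 <_) ρ′ → oddLength ρ ≡ oddLength ρ′ → cfFrac ρ ≡ cfFrac ρ′ → ρ ≡ ρ′
  cfFrac-injective []         []          _ _ = refl
  cfFrac-injective []         (_ ∷ τ′>0) _ eq = ⊥-elim (<⇒≢ (den-pos τ′>0) (cong proj₁ eq))
  cfFrac-injective (_ ∷ τ>0)  []          _ eq = ⊥-elim (<⇒≢ (den-pos τ>0) (sym (cong proj₁ eq)))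
  cfFrac-injective {x ∷ τ} {x′ ∷ τ′} (_ ∷ τ>0) (_ ∷ τ′>0) par eq =
    cong₂ _∷_ x≡x′ (cfFrac-injective τ>0 τ′>0 par′ (cong₂ _,_ num≡ den≡))
    where
    par′ : oddLength τ ≡ oddLength τ′
    par′ = not-injective par
    den≡ : den τ ≡ den τ′
    den≡ = cong proj₁ eq
    val≡ : x * den τ + num τ ≡ x′ * den τ′ + num τ′
    val≡ = cong proj₂ eq
    num≡ : num τ ≡ num τ′
    num≡ = num-agree {x} {x′} τ>0 τ′>0 par′ den≡ val≡
    x≡x′ : x ≡ x′
    x≡x′ = *-cancelʳ-≡ x x′ (den τ) {{>-nonZero (den-pos τ>0)}}
             (+-cancelʳ-≡ (num τ) _ _ (trans val≡ (cong₂ (λ d n → x′ * d + n) (sym den≡) (sym num≡))))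

  record Expansion (j k : ℕ) (b : Bool) : Set where
    field
      digits           : List ℕ
      digits-inRange   : All (InRange j) digits
      length-digits    : length digits ≤ suc k
      oddLength-digits : oddLength digits ≡ b
      cfFrac-digits    : cfFrac digits ≡ (k , j)

  expansion-1 : 1 < j → ∀ b → Expansion j 1 b
  expansion-1 {suc zero} (s≤s ())
  expansion-1 {suc (suc i)} _ true = record
    { digits = [ suc (suc i) ] ; digits-inRange = (z<s , ≤-refl) ∷ [] ; length-digits = s≤s z≤n
    ; oddLength-digits = refl ; cfFrac-digits = cong (1 ,_) (trans (+-identityʳ _) (*-identityʳ _)) }
  expansion-1 {suc (suc i)} _ false = record
    { digits = suc i ∷ 1 ∷ [] ; digits-inRange = (z<s , n≤1+n _) ∷ (z<s , s≤s z≤n) ∷ [] ; length-digits = ≤-refl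
    ; oddLength-digits = refl ; cfFrac-digits = cong (1 ,_) (trans (cong (_+ 1) (*-identityʳ (suc i))) (+-comm (suc i) 1)) }

  expansion-∷ : ∀ {q r b} → 0 < q → r < k → j ≡ q * k + r → Expansion k r (not b) → Expansion j k b
  expansion-∷ {k} {j} {q} {r} {b} q>0 r<k j≡ E = record
    { digits = q ∷ digits
    ; digits-inRange = (q>0 , q≤j) ∷ All.map (λ (a>0 , a≤k) → a>0 , ≤-trans a≤k k≤j) digits-inRange
    ; length-digits = s≤s (≤-trans length-digits r<k)
    ; oddLength-digits = trans (cong not oddLength-digits) (not-involutive b)
    ; cfFrac-digits = trans (cong (λ (p , d) → d , q * d + p) cfFrac-digits) (cong (k ,_) (sym j≡)) }
    where
    open Expansion E
    q*k≤j : q * k ≤ j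
    q*k≤j = ≤-trans (m≤m+n (q * k) r) (≤-reflexive (sym j≡))
    q≤j : q ≤ j
    q≤j = ≤-trans (m≤m*n q k {{>-nonZero (≤-<-trans z≤n r<k)}}) q*k≤j
    k≤j : k ≤ j
    k≤j = ≤-trans (m≤n*m k q {{>-nonZero q>0}}) q*k≤j

  -- Euclid's algorithm on (j , k) ↦ (k , j % k); the parity is chosen in the last step, [ j ] or [ j ∸ 1 , 1 ].
  expansion : Acc _<_ k → 0 < k → k < j → Coprime j k → ∀ b → Expansion j k b
  expansion {k@(suc _)} {j} (acc rec) _ k<j coprime b with j % k in j%k≡r
  ... | zero  = subst (λ k → Expansion j k b) (sym k≡1) (expansion-1 (subst (_< j) k≡1 k<j) b)
    where
    k≡1 : k ≡ 1
    k≡1 = coprime (m%n≡0⇒n∣m j k j%k≡r , ∣-refl)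
  ... | suc r = expansion-∷ (m≥n⇒m/n>0 (<⇒≤ k<j)) r<k j≡ (expansion (rec r<k) z<s r<k coprime′ (not b))
    where
    j≡ : j ≡ j / k * k + suc r
    j≡ = trans (m≡m%n+[m/n]*n j k) (trans (cong (_+ j / k * k) j%k≡r) (+-comm (suc r) _))
    r<k : suc r < k
    r<k = subst (_< k) j%k≡r (m%n<n j k)
    coprime′ : Coprime k (suc r)
    coprime′ = coprime-*+⁻ (j / k) (subst (Coprime k) j≡ (Coprimality.sym coprime))

module Counting where

  open ContinuedFractions
  open import Data.Nat using (_≤_; _<_; z≤n; s≤s; z<s)
  open import Data.Nat.Divisibility using (∣-refl; _∣0)
  open import Data.Nat.GCD using (gcd)
  open import Data.Nat.Induction using (<-wellFounded)
  open import Data.Nat.Properties using (_≟_; suc-injective; ≤-trans; <⇒≢; n≤1+n; n≮n; m≤n⇒m<n∨m≡n; m^n>0; ^-monoʳ-≤)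

  private
    variable
      N : ℕ

  ∈-oneTo⁺ : ∀ {a} → InRange N a → a ∈ oneTo N
  ∈-oneTo⁺ {a = suc a} (_ , a<N) = ∈-map⁺ suc (∈-upTo⁺ a<N)

  ∈-oneTo⁻ : ∀ {a} → a ∈ oneTo N → InRange N a
  ∈-oneTo⁻ a∈ with ∈-map⁻ suc a∈
  ... | _ , b∈ , refl = z<s , ∈-upTo⁻ b∈

  oneTo-unique : ∀ N → Unique (oneTo N)
  oneTo-unique N = map⁺ suc-injective (upTo⁺ N)

  ∈-tuples⁺ : ∀ {N n} (σ : Vec ℕ n) → All (InRange N) (toList σ) → σ ∈ tuples N n
  ∈-tuples⁺ Vec.[] [] = here refl
  ∈-tuples⁺ {N} {suc n} (a Vec.∷ σ) (a∈ ∷ σ∈range) =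
    ∈-concatMap⁺′ (λ a → map (a Vec.∷_) (tuples N n)) (∈-oneTo⁺ a∈) (∈-map⁺ (a Vec.∷_) (∈-tuples⁺ σ σ∈range))

  ∈-tuples⁻ : ∀ {N n} {σ : Vec ℕ n} → σ ∈ tuples N n → All (InRange N) (toList σ)
  ∈-tuples⁻ {n = zero}  (here refl) = []
  ∈-tuples⁻ {N} {suc n} σ∈ with ∈-concatMap⁻′ (λ a → map (a Vec.∷_) (tuples N n)) (oneTo N) σ∈
  ... | a , a∈ , σ∈′ with ∈-map⁻ (a Vec.∷_) σ∈′
  ... | τ , τ∈ , refl = ∈-oneTo⁻ a∈ ∷ ∈-tuples⁻ τ∈

  tuples-unique : ∀ N n → Unique (tuples N n)
  tuples-unique N zero    = [] ∷ []
  tuples-unique N (suc n) = concatMap-unique Vec.head (oneTo-unique N)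
    (λ a → map⁺ (λ { refl → refl }) (tuples-unique N n)) head-key
    where
    head-key : ∀ {a} {σ : Vec ℕ (suc n)} → σ ∈ map (a Vec.∷_) (tuples N n) → Vec.head σ ≡ a
    head-key σ∈ with ∈-map⁻ _ σ∈
    ... | _ , _ , refl = refl

  words : ℕ → List (List ℕ)
  words N = concatMap (λ n → map (reverse ∘ toList) (tuples N n)) (oneTo N)

  ∈-words⁺ : ∀ {N ρ} → All (InRange N) ρ → InRange N (length ρ) → ρ ∈ words N
  ∈-words⁺ {N} {ρ} ρ∈range length∈range =
    ∈-concatMap⁺′ (λ n → map (reverse ∘ toList) (tuples N n))
      (∈-oneTo⁺ (subst (InRange N) (sym (length-reverse ρ)) length∈range))
      (subst (_∈ map (reverse ∘ toList) (tuples N (length (reverse ρ)))) reverse-toList-σ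
        (∈-map⁺ (reverse ∘ toList) (∈-tuples⁺ σ σ∈range)))
    where
    σ : Vec ℕ (length (reverse ρ))
    σ = fromList (reverse ρ)
    σ∈range : All (InRange N) (toList σ)
    σ∈range = subst (All (InRange N)) (sym (toList∘fromList (reverse ρ))) (All-reverse ρ∈range)
    reverse-toList-σ : reverse (toList σ) ≡ ρ
    reverse-toList-σ = trans (cong reverse (toList∘fromList (reverse ρ))) (reverse-involutive ρ)

  ∈-words⁻ : ∀ {N ρ} → ρ ∈ words N → All (InRange N) ρ × InRange N (length ρ)
  ∈-words⁻ {N} ρ∈ with ∈-concatMap⁻′ (λ n → map (reverse ∘ toList) (tuples N n)) (oneTo N) ρ∈
  ... | n , n∈ , ρ∈′ with ∈-map⁻ (reverse ∘ toList) ρ∈′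
  ... | σ , σ∈ , refl = All-reverse (∈-tuples⁻ σ∈)
                      , subst (InRange N) (sym (trans (length-reverse (toList σ)) (length-toList σ))) (∈-oneTo⁻ n∈)

  words-unique : ∀ N → Unique (words N)
  words-unique N = concatMap-unique length (oneTo-unique N)
    (λ n → map⁺ (λ {σ} {τ} eq → trans (sym (cast-is-id refl σ)) (toList-injective refl σ τ (reverse-injective eq)))
             (tuples-unique N n))
    length-key
    where
    length-key : ∀ {n ρ} → ρ ∈ map (reverse ∘ toList) (tuples N n) → length ρ ≡ n
    length-key ρ∈ with ∈-map⁻ _ ρ∈
    ... | σ , _ , refl = trans (length-reverse (toList σ)) (length-toList σ)

  coprimeBelow : ℕ → List (ℕ × ℕ)
  coprimeBelow j = map (j ,_) (filter (λ k → gcd j k ≟ 1) (upTo j))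

  coprimePairs : ℕ → List (ℕ × ℕ)
  coprimePairs N = concatMap coprimeBelow (oneTo N)

  ∈-coprimePairs⁺ : ∀ {N j k} → InRange N j → k < j → Coprime j k → (j , k) ∈ coprimePairs N
  ∈-coprimePairs⁺ {N} {j} j∈range k<j coprime =
    ∈-concatMap⁺′ coprimeBelow (∈-oneTo⁺ j∈range)
      (∈-map⁺ (j ,_) (∈-filter⁺ (λ k → gcd j k ≟ 1) (∈-upTo⁺ k<j) (coprime⇒gcd≡1 coprime)))

  ∈-coprimePairs⁻ : ∀ {N j k} → (j , k) ∈ coprimePairs N → InRange N j × k < j × Coprime j k
  ∈-coprimePairs⁻ {N} p∈ with ∈-concatMap⁻′ coprimeBelow (oneTo N) p∈
  ... | j , j∈ , p∈′ with ∈-map⁻ (j ,_) p∈′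
  ... | k , k∈ , refl with ∈-filter⁻ (λ k → gcd j k ≟ 1) k∈
  ... | k∈upTo , gcd≡1 = ∈-oneTo⁻ j∈ , ∈-upTo⁻ k∈upTo , gcd≡1⇒coprime gcd≡1

  coprimePairs-unique : ∀ N → Unique (coprimePairs N)
  coprimePairs-unique N = concatMap-unique proj₁ (oneTo-unique N)
    (λ j → map⁺ (cong proj₂) (filter⁺ (λ k → gcd j k ≟ 1) (upTo⁺ j))) first-key
    where
    first-key : ∀ {j p} → p ∈ coprimeBelow j → proj₁ p ≡ j
    first-key p∈ with ∈-map⁻ _ p∈
    ... | _ , _ , refl = refl

  label : List ℕ → Bool × ℕ × ℕ
  label ρ = oddLength ρ , den ρ , num ρ

  -- The two entries (b , 1 , 0) stand in for (1, 0), which labels no word of positive length.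
  source : ℕ → List (Bool × ℕ × ℕ)
  source N = (true , 1 , 0) ∷ (false , 1 , 0) ∷ map label (words N)

  target : ℕ → List (Bool × ℕ × ℕ)
  target N = (true , 1 , 1) ∷ map (false ,_) (coprimePairs N) ++ map (true ,_) (coprimePairs N)

  source-unique : ∀ N → Unique (source N)
  source-unique N =
    ((λ ()) ∷ All.¬Any⇒All¬ _ (1,0∉ true))
    ∷ All.¬Any⇒All¬ _ (1,0∉ false)
    ∷ map-unique (words-unique N) label-injective
    where
    word-positive : ∀ {ρ} → ρ ∈ words N → All (0 <_) ρ
    word-positive ρ∈ = positive (proj₁ (∈-words⁻ {N} ρ∈))
    1,0∉ : ∀ b → (b , 1 , 0) ∉ map label (words N)
    1,0∉ b x∈ with ∈-map⁻ label x∈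
    ... | ρ , ρ∈ , eq = <⇒≢ (num-pos (word-positive ρ∈) (proj₁ (proj₂ (∈-words⁻ {N} ρ∈)))) (cong (proj₂ ∘ proj₂) eq)
    label-injective : ∀ {ρ ρ′} → ρ ∈ words N → ρ′ ∈ words N → label ρ ≡ label ρ′ → ρ ≡ ρ′
    label-injective ρ∈ ρ′∈ eq = cfFrac-injective (word-positive ρ∈) (word-positive ρ′∈) (cong proj₁ eq)
      (cong₂ _,_ (cong (proj₂ ∘ proj₂) eq) (cong (proj₁ ∘ proj₂) eq))

  ∈-tagged⁻ : ∀ {b b′ : Bool} {p : ℕ × ℕ} {ps} → (b , p) ∈ map (b′ ,_) ps → p ∈ ps
  ∈-tagged⁻ x∈ with ∈-map⁻ _ x∈
  ... | _ , p∈ , refl = p∈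

  target-unique : ∀ N → Unique (target N)
  target-unique N = All.¬Any⇒All¬ _ 1,1∉ ∷ ++⁺ (tagged-unique false) (tagged-unique true) tags-disjoint
    where
    tagged-unique : ∀ b → Unique (map (b ,_) (coprimePairs N))
    tagged-unique b = map⁺ (cong proj₂) (coprimePairs-unique N)
    1,1∉ : ∀ {b} → (b , 1 , 1) ∉ map (false ,_) (coprimePairs N) ++ map (true ,_) (coprimePairs N)
    1,1∉ x∈ with ∈-++⁻ (map (false ,_) (coprimePairs N)) x∈
    ... | inj₁ x∈₁ = n≮n 1 (proj₁ (proj₂ (∈-coprimePairs⁻ {N} (∈-tagged⁻ x∈₁))))
    ... | inj₂ x∈₂ = n≮n 1 (proj₁ (proj₂ (∈-coprimePairs⁻ {N} (∈-tagged⁻ x∈₂))))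
    tags-disjoint : Disjoint (map (false ,_) (coprimePairs N)) (map (true ,_) (coprimePairs N))
    tags-disjoint (x∈₁ , x∈₂) with ∈-map⁻ (false ,_) x∈₁ | ∈-map⁻ (true ,_) x∈₂
    ... | _ , _ , refl | _ , _ , ()

  ∈-target : ∀ {N j k} b → (j , k) ∈ coprimePairs N → (b , j , k) ∈ target N
  ∈-target false p∈ = there (∈-++⁺ˡ (∈-map⁺ (false ,_) p∈))
  ∈-target true  p∈ = there (∈-++⁺ʳ _ (∈-map⁺ (true ,_) p∈))

  label∈target : ∀ {N ρ} → All (InRange N) ρ → length ρ ≤ N → label ρ ∈ target (suc N ^ N)
  label∈target {N} {ρ} ρ∈range length≤N with m≤n⇒m<n∨m≡n (num≤den (positive ρ∈range))
  ... | inj₁ num<den = ∈-target {suc N ^ N} (oddLength ρ)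
    (∈-coprimePairs⁺ (den-pos (positive ρ∈range) , ≤-trans (den≤^length ρ∈range) (^-monoʳ-≤ (suc N) length≤N))
      num<den (Coprimality.sym (cfFrac-coprime ρ)))
  ... | inj₂ num≡den with num≡den⇒≡[1] (positive ρ∈range) num≡den
  ...   | refl = here refl

  1,0∈coprimePairs : ∀ N → (1 , 0) ∈ coprimePairs (suc N ^ N)
  1,0∈coprimePairs N = ∈-coprimePairs⁺ (z<s , m^n>0 (suc N) N) z<s (1-coprimeTo 0)

  source⊆target : ∀ N → source N ⊆ target (suc N ^ N)
  source⊆target N (here refl)        = ∈-target {suc N ^ N} true  (1,0∈coprimePairs N)
  source⊆target N (there (here refl)) = ∈-target {suc N ^ N} false (1,0∈coprimePairs N)
  source⊆target N (there (there x∈)) with ∈-map⁻ label x∈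
  ... | ρ , ρ∈ , refl with ∈-words⁻ {N} ρ∈
  ...   | ρ∈range , _ , length≤N = label∈target ρ∈range length≤N

  pair∈source : ∀ {N j k} b → (j , k) ∈ coprimePairs N → (b , j , k) ∈ source (suc N)
  pair∈source {N} {j} {zero} b p∈ with proj₂ (proj₂ (∈-coprimePairs⁻ {N} p∈)) (∣-refl , j ∣0)
  pair∈source true  _ | refl = here refl
  pair∈source false _ | refl = there (here refl)
  pair∈source {N} {j} {suc k} b p∈ with ∈-coprimePairs⁻ {N} p∈
  ... | (_ , j≤N) , k<j , coprime =
    there (there (subst (_∈ map label (words (suc N))) label-digits
                        (∈-map⁺ label (∈-words⁺ {suc N} digits∈range length∈range))))
    where
    open Expansion (expansion (<-wellFounded (suc k)) z<s k<j coprime b)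
    j≤1+N : j ≤ suc N
    j≤1+N = ≤-trans j≤N (n≤1+n N)
    digits∈range : All (InRange (suc N)) digits
    digits∈range = All.map (λ (a>0 , a≤j) → a>0 , ≤-trans a≤j j≤1+N) digits-inRange
    length∈range : InRange (suc N) (length digits)
    length∈range = num-pos⇒length-pos digits (subst (0 <_) (sym (cong proj₁ cfFrac-digits)) z<s)
                 , ≤-trans length-digits (≤-trans k<j j≤1+N)
    label-digits : label digits ≡ (b , j , suc k)
    label-digits = cong₂ _,_ oddLength-digits (cong₂ _,_ (cong proj₂ cfFrac-digits) (cong proj₁ cfFrac-digits))

  target⊆source : ∀ N → target N ⊆ source (suc N)
  target⊆source N (here refl) =
    there (there (∈-map⁺ label (∈-words⁺ {suc N} ((z<s , s≤s z≤n) ∷ []) (z<s , s≤s z≤n))))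
  target⊆source N {b , j , k} (there x∈) with ∈-++⁻ (map (false ,_) (coprimePairs N)) x∈
  ... | inj₁ x∈₁ = pair∈source {N} b (∈-tagged⁻ x∈₁)
  ... | inj₂ x∈₂ = pair∈source {N} b (∈-tagged⁻ x∈₂)

open ContinuedFractions
open Counting
open import Data.Rational using (ℚ; 0ℚ; _+_; _≤_)
open import Data.Rational.Properties
  using (+-identityˡ; +-assoc; +-comm; +-mono-≤; +-monoʳ-≤; ≤-refl; +-0-commutativeMonoid; module ≤-Reasoning)
open import Algebra.Bundles using (CommutativeMonoid)
open import Algebra.Properties.CommutativeSemigroup (CommutativeMonoid.commutativeSemigroup +-0-commutativeMonoid)
  using (x∙yz≈y∙xz)

sumℚ-++ : ∀ xs ys → sumℚ (xs ++ ys) ≡ sumℚ xs + sumℚ ys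
sumℚ-++ []       ys = sym (+-identityˡ (sumℚ ys))
sumℚ-++ (x ∷ xs) ys = trans (cong (x +_) (sumℚ-++ xs ys)) (sym (+-assoc x (sumℚ xs) (sumℚ ys)))

module _ {A : Set} (w : A → ℚ) (w≥0 : ∀ x → 0ℚ ≤ w x) where

  sumℚ-nonneg : ∀ xs → 0ℚ ≤ sumℚ (map w xs)
  sumℚ-nonneg []       = ≤-refl
  sumℚ-nonneg (x ∷ xs) = subst (_≤ w x + sumℚ (map w xs)) (+-identityˡ 0ℚ) (+-mono-≤ (w≥0 x) (sumℚ-nonneg xs))

  sumℚ-insert : ∀ xs {x} ys → sumℚ (map w (xs ++ x ∷ ys)) ≡ w x + sumℚ (map w (xs ++ ys))
  sumℚ-insert []       ys = refl
  sumℚ-insert (y ∷ xs) {x} ys = trans (cong (w y +_) (sumℚ-insert xs ys)) (x∙yz≈y∙xz (w y) (w x) _)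

  sumℚ-mono-⊆ : ∀ {xs ys} → Unique xs → xs ⊆ ys → sumℚ (map w xs) ≤ sumℚ (map w ys)
  sumℚ-mono-⊆ {[]}     {ys} _ _ = sumℚ-nonneg ys
  sumℚ-mono-⊆ {x ∷ xs} (x∉ ∷ xs!) x∷xs⊆ys with ∈-∃++ (x∷xs⊆ys (here refl))
  ... | ys₁ , ys₂ , refl = begin
    w x + sumℚ (map w xs)                ≤⟨ +-monoʳ-≤ (w x) (sumℚ-mono-⊆ xs! xs⊆ys₁++ys₂) ⟩
    w x + sumℚ (map w (ys₁ ++ ys₂))      ≡⟨ sumℚ-insert ys₁ ys₂ ⟨
    sumℚ (map w (ys₁ ++ x ∷ ys₂))        ∎
    where
    open ≤-Reasoning
    xs⊆ys₁++ys₂ : xs ⊆ ys₁ ++ ys₂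
    xs⊆ys₁++ys₂ y∈ with ∈-++⁻ ys₁ (x∷xs⊆ys (there y∈))
    ... | inj₁ y∈ys₁         = ∈-++⁺ˡ y∈ys₁
    ... | inj₂ (here refl)   = ⊥-elim (All.lookup x∉ y∈ refl)
    ... | inj₂ (there y∈ys₂) = ∈-++⁺ʳ ys₁ y∈ys₂

module _ (Φ : ℕ → ℕ → ℚ) where

  Spartial-words : ∀ N → Spartial Φ N ≡ sumℚ (map (λ ρ → Φ (den ρ) (num ρ)) (words N))
  Spartial-words N = cong sumℚ (begin
    concatMap F (map suc (upTo N))          ≡⟨ concatMap-map F suc (upTo N) ⟩
    concatMap (F ∘ suc) (upTo N)            ≡⟨ concatMap-cong F≗ (upTo N) ⟩
    concatMap (map wt ∘ G ∘ suc) (upTo N)   ≡⟨ concatMap-map (map wt ∘ G) suc (upTo N) ⟨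
    concatMap (map wt ∘ G) (oneTo N)        ≡⟨ map-concatMap wt G (oneTo N) ⟨
    map wt (words N)                        ∎)
    where
    open ≡-Reasoning
    wt : List ℕ → ℚ
    wt ρ = Φ (den ρ) (num ρ)
    F : (n : ℕ) → List ℚ
    F n = map (λ σ → Φ (qStar σ n) (qStar σ (n ∸ 1))) (tuples N n)
    G : (n : ℕ) → List (List ℕ)
    G n = map (reverse ∘ toList) (tuples N n)
    F≗ : ∀ m → F (suc m) ≡ map wt (G (suc m))
    F≗ m = trans (map-cong (λ σ → cong₂ Φ (qStar-last σ) (qStar-init σ)) (tuples N (suc m))) (map-∘ (tuples N (suc m)))

  Tpartial-coprimePairs : ∀ N → Tpartial Φ N ≡ sumℚ (map (uncurry Φ) (coprimePairs N))
  Tpartial-coprimePairs N = cong sumℚ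
    (trans (concatMap-cong (λ j → map-∘ _) (oneTo N)) (sym (map-concatMap (uncurry Φ) coprimeBelow (oneTo N))))

  weight : Bool × ℕ × ℕ → ℚ
  weight (_ , j , k) = Φ j k

  sum-source : ∀ N → sumℚ (map weight (source N)) ≡ Spartial Φ N + twice (Φ 1 0)
  sum-source N = begin
    Φ 1 0 + (Φ 1 0 + sumℚ (map weight (map label (words N))))  ≡⟨ cong (λ s → Φ 1 0 + (Φ 1 0 + s)) words-sum ⟩
    Φ 1 0 + (Φ 1 0 + Spartial Φ N)                              ≡⟨ +-assoc (Φ 1 0) (Φ 1 0) _ ⟨
    twice (Φ 1 0) + Spartial Φ N                                 ≡⟨ +-comm (twice (Φ 1 0)) _ ⟩
    Spartial Φ N + twice (Φ 1 0)                                 ∎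
    where
    open ≡-Reasoning
    words-sum : sumℚ (map weight (map label (words N))) ≡ Spartial Φ N
    words-sum = trans (cong sumℚ (sym (map-∘ (words N)))) (sym (Spartial-words N))

  sum-target : ∀ N → sumℚ (map weight (target N)) ≡ Φ 1 1 + twice (Tpartial Φ N)
  sum-target N = cong (Φ 1 1 +_) (begin
    sumℚ (map weight (tagged false ++ tagged true))                    ≡⟨ cong sumℚ (map-++ weight (tagged false) _) ⟩
    sumℚ (map weight (tagged false) ++ map weight (tagged true))       ≡⟨ sumℚ-++ (map weight (tagged false)) _ ⟩
    sumℚ (map weight (tagged false)) + sumℚ (map weight (tagged true)) ≡⟨ cong₂ _+_ (tagged-sum false) (tagged-sum true) ⟩
    twice (Tpartial Φ N)                                               ∎)
    where
    open ≡-Reasoning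
    tagged : Bool → List (Bool × ℕ × ℕ)
    tagged b = map (b ,_) (coprimePairs N)
    tagged-sum : ∀ b → sumℚ (map weight (tagged b)) ≡ Tpartial Φ N
    tagged-sum b = trans (cong sumℚ (sym (map-∘ (coprimePairs N)))) (sym (Tpartial-coprimePairs N))

lemma4p2 : (Φ : ℕ → ℕ → ℚ) → (∀ j k → 0ℚ ≤ Φ j k) →
    SupEq (λ N → Spartial Φ N + twice (Φ 1 0))
          (λ N → Φ 1 1 + twice (Tpartial Φ N))
lemma4p2 Φ Φ≥0 =
  (λ N → suc N ^ N , subst₂ _≤_ (sum-source Φ N) (sum-target Φ (suc N ^ N))
                                (sum-mono (source-unique N) (source⊆target N))) ,
  (λ N → suc N , subst₂ _≤_ (sum-target Φ N) (sum-source Φ (suc N))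
                            (sum-mono (target-unique N) (target⊆source N)))
  where
  sum-mono : ∀ {xs ys} → Unique xs → xs ⊆ ys → sumℚ (map (weight Φ) xs) ≤ sumℚ (map (weight Φ) ys)
  sum-mono = sumℚ-mono-⊆ (weight Φ) (λ (_ , j , k) → Φ≥0 j k)
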